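{- Let $G=(V,E)$ be a finite graph whose edges are given a fixed total ordering, and let $t$ be a positive integer. Let $\mathcal{S}$ be the set of pairs $(S,\kappa)$ with $S\subseteq E$ and $\kappa:V\to\{1,\dots,t\}$ monochromatic on the components of $S$, with sign $\operatorname{sgn}(S,\kappa)=(-1)^{|S|}$. Define $\iota$ on $\mathcal{S}$ by: if $\kappa$ is a proper coloring of $G$, $\iota(S,\kappa)=(S,\kappa)$; otherwise $\iota(S,\kappa)=(S\,\triangle\,\{e\},\kappa)$ where $e$ is the last (in the fixed ordering) edge of $G$ that is monochromatic under $\kappa$. Then $\iota$ restricts to a fixed-point-free sign-reversing involution on the subset of $\mathcal{S}$ consisting of those pairs $(S,\kappa)$ for which $S$ contains a broken circuit.
   Context: A spanning subgraph of $G$ is identified with its edge set $S\subseteq E$. A coloring $\kappa$ is monochromatic on the components of $S$ if $\kappa(u)=\kappa(v)$ whenever $u,v$ lie in the same connected component of $(V,S)$. An edge $uv$ is monochromatic under $\kappa$ if $\kappa(u)=\kappa(v)$; $\kappa$ is proper if no edge is monochromatic. A cycle is a closed path with more than one vertex that repeats no vertices or edges (other than first = last vertex), identified with its edge set. Given the total ordering of $E$, a broken circuit is a set $C\setminus\{\max C\}$ where $C$ is a cycle of $G$ and $\max C$ its last edge. A sign-reversing involution on $\mathcal{T}$ with sign function $\operatorname{sgn}$ is an involution $\iota:\mathcal{T}\to\mathcal{T}$ such that fixed points have sign $+1$ and $\operatorname{sgn}(\iota(s))=-\operatorname{sgn}(s)$ whenever $\iota(s)\neq s$; fixed-point-free means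 $\iota(s)\neq s$ for all $s$. -}

module Defs where

open import Data.Nat as ℕ using (ℕ; zero; suc; _≤_)
open import Data.Fin using (Fin; zero; suc; inject₁; fromℕ; toℕ)
open import Data.Fin.Subset using (Subset; _∈_; _∉_; ∣_∣)
open import Data.Vec using (Vec; _[_]%=_)
open import Data.Bool using (Bool; not)
open import Data.Product using (Σ; ∃; ∃-syntax; _×_; _,_)
open import Data.Sum using (_⊎_)
open import Data.Maybe using (Maybe; just; nothing)
open import Data.Integer as ℤ using (ℤ; -1ℤ)
open import Relation.Nullary using (¬_; yes; no)
open import Relation.Binary.PropositionalEquality using (_≡_; _≢_)
open import Relation.Binary.Construct.Closure.ReflexiveTransitive using (Star)
open import Data.Fin.Properties using (_≟_)

-- A finite graph (multigraph; loops and parallel edges allowed) with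
-- vertex set Fin n and edge set Fin m.
-- The fixed total ordering of E is the natural order on Fin m.
Graph : ℕ → ℕ → Set
Graph n m = Fin m → Fin n × Fin n

Joins : ∀ {n m} → Graph n m → Fin m → Fin n → Fin n → Set
Joins ends e u v = ends e ≡ (u , v) ⊎ ends e ≡ (v , u)

AdjIn : ∀ {n m} → Graph n m → Subset m → Fin n → Fin n → Set
AdjIn ends S u v = ∃[ e ] (e ∈ S × Joins ends e u v)

SameComponent : ∀ {n m} → Graph n m → Subset m → Fin n → Fin n → Set
SameComponent ends S = Star (AdjIn ends S)

MonoOnComponents : ∀ {n m t} → Graph n m → Subset m → (Fin n → Fin t) → Set
MonoOnComponents ends S κ = ∀ u v → SameComponent ends S u v → κ u ≡ κ v

MonoEdge : ∀ {n m t} → Graph n m → (Fin n → Fin t) → Fin m → Set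
MonoEdge ends κ e with ends e
... | (u , v) = κ u ≡ κ v

Proper : ∀ {n m t} → Graph n m → (Fin n → Fin t) → Set
Proper ends κ = ∀ e → ¬ MonoEdge ends κ e

record CycleData {n m} (ends : Graph n m) : Set where
  field
    k      : ℕ
    k≥2    : 2 ≤ k
    vs     : Fin (suc k) → Fin n
    es     : Fin k → Fin m
    closed : vs zero ≡ vs (fromℕ k)
    vsInj  : ∀ i j → vs (inject₁ i) ≡ vs (inject₁ j) → i ≡ j
    esInj  : ∀ i j → es i ≡ es j → i ≡ j
    joins  : ∀ i → Joins ends (es i) (vs (inject₁ i)) (vs (suc i))

-- B is a broken circuit: B = C ∖ {max C} for the edge set C of some cycle
IsBrokenCircuit : ∀ {n m} → Graph n m → Subset m → Set
IsBrokenCircuit ends B =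
  Σ (CycleData ends) λ c → let open CycleData c in
  Σ (Fin k) λ i₀ →
    (∀ j → toℕ (es j) ≤ toℕ (es i₀)) ×
    (∀ e → (e ∈ B → ∃[ j ] (es j ≡ e × es j ≢ es i₀))
         × (∀ j → es j ≡ e → es j ≢ es i₀ → e ∈ B))

ContainsBrokenCircuit : ∀ {n m} → Graph n m → Subset m → Set
ContainsBrokenCircuit ends S =
  ∃[ B ] (IsBrokenCircuit ends B × (∀ e → e ∈ B → e ∈ S))

sgn : ∀ {m} → Subset m → ℤ
sgn S = -1ℤ ℤ.^ ∣ S ∣

-- the last (largest index) edge monochromatic under κ, if any
-- (nothing exactly when κ is proper)
lastMono : ∀ {n m t} → Graph n m → (Fin n → Fin t) → Maybe (Fin m)
lastMono {m = zero} ends κ = nothing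
lastMono {m = suc m} ends κ with lastMono (λ e → ends (suc e)) κ
... | just e = just (suc e)
... | nothing with ends zero
...   | (u , v) with κ u ≟ κ v
...     | yes _ = just zero
...     | no _ = nothing

toggle : ∀ {m} → Subset m → Fin m → Subset m
toggle S e = S [ e ]%= not

ι : ∀ {n m t} → Graph n m → Subset m × (Fin n → Fin t) → Subset m × (Fin n → Fin t)
ι ends (S , κ) with lastMono ends κ
... | nothing = (S , κ)
... | just e = (toggle S e , κ)

InT : ∀ {n m t} → Graph n m → Subset m × (Fin n → Fin t) → Set
InT ends (S , κ) = MonoOnComponents ends S κ × ContainsBrokenCircuit ends S

module Submission where

-- Write Mono κ e when the two ends of e get the same colour, and let e be
-- the last such edge (the value of lastMono).  The whole proposition
-- rests on one observation: if κ is monochromatic on the components of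
-- S and S contains the broken circuit C ∖ {max C}, then the colour is
-- constant along the path C ∖ {max C}, which closes up through max C, so
-- max C is monochromatic.  Hence κ is not proper, ι toggles e, and every
-- edge of the broken circuit lies strictly below max C ≤ e; in
-- particular e is not in it, so toggling e keeps the broken circuit.
-- Toggling a monochromatic edge also keeps κ monochromatic on the new
-- components, and the choice of e depends only on κ, so ι is an
-- involution; toggling changes |S| by one, which reverses the sign.

open import Defs
open import Data.Nat using (ℕ; zero; suc; z≤n; s≤s; _≤_; _<_)
open import Data.Nat.Properties using (≤∧≢⇒<; <-≤-trans; <-irrefl)
open import Data.Fin using (Fin; zero; suc; inject₁; fromℕ; toℕ; _≟_)
open import Data.Fin.Properties using (suc-injective; toℕ-injective)
open import Data.Fin.Subset using (Subset; _∈_; ∣_∣; inside; outside)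
open import Data.Vec using (_∷_; lookup)
open import Data.Vec.Properties using (updateAt-minimal; updateAt-updateAt-local; updateAt-id; lookup∘updateAt)
open import Data.Bool.Properties using (not-involutive; not-¬)
open import Data.Product using (_×_; _,_; proj₁; proj₂; ∃-syntax)
open import Data.Sum using (_⊎_; inj₁; inj₂)
open import Data.Maybe using (Maybe; just; nothing)
open import Data.Empty using (⊥-elim)
open import Data.Integer using (-_; -1ℤ; _^_)
open import Data.Integer.Properties using (-1*i≡-i; neg-involutive)
open import Relation.Nullary using (¬_; yes; no)
open import Relation.Binary.PropositionalEquality using (_≡_; _≢_; refl; sym; trans; cong; subst; module ≡-Reasoning)
open import Relation.Binary.Construct.Closure.ReflexiveTransitive using (ε; _◅_; fold)

-- A sequence f 0, …, f k "agrees except at i₀" when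
-- every step f j = f (j+1) holds for j ≠ i₀; along a cycle this is the
-- statement that all edges but es i₀ join vertices of equal colour.

AgreesExcept : ∀ {A : Set} {k} → (Fin (suc k) → A) → Fin k → Set
AgreesExcept f i₀ = ∀ j → j ≢ i₀ → f (inject₁ j) ≡ f (suc j)

agreesExcept-tail : ∀ {A : Set} {k} {f : Fin (suc (suc k)) → A} {i₀ : Fin k} →
  AgreesExcept f (suc i₀) → AgreesExcept (λ x → f (suc x)) i₀
agreesExcept-tail agree j j≢i₀ = agree (suc j) (λ eq → j≢i₀ (suc-injective eq))

agrees-everywhere : ∀ {A : Set} k (f : Fin (suc k) → A) →
  (∀ j → f (inject₁ j) ≡ f (suc j)) → f zero ≡ f (fromℕ k)
agrees-everywhere zero    f agree = refl
agrees-everywhere (suc k) f agree =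
  trans (agree zero) (agrees-everywhere k (λ x → f (suc x)) (λ j → agree (suc j)))

agrees-before : ∀ {A : Set} k (f : Fin (suc k) → A) (i₀ : Fin k) →
  AgreesExcept f i₀ → f zero ≡ f (inject₁ i₀)
agrees-before (suc k) f zero     agree = refl
agrees-before (suc k) f (suc i₀) agree =
  trans (agree zero (λ ())) (agrees-before k (λ x → f (suc x)) i₀ (agreesExcept-tail {f = f} agree))

agrees-after : ∀ {A : Set} k (f : Fin (suc k) → A) (i₀ : Fin k) →
  AgreesExcept f i₀ → f (suc i₀) ≡ f (fromℕ k)
agrees-after (suc k) f zero     agree =
  agrees-everywhere k (λ x → f (suc x)) (λ j → agree (suc j) (λ ()))
agrees-after (suc k) f (suc i₀) agree =
  agrees-after k (λ x → f (suc x)) i₀ (agreesExcept-tail {f = f} agree)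

closing-step-agrees : ∀ {A : Set} k (f : Fin (suc k) → A) (i₀ : Fin k) →
  AgreesExcept f i₀ → f zero ≡ f (fromℕ k) → f (inject₁ i₀) ≡ f (suc i₀)
closing-step-agrees k f i₀ agree closed = begin
  f (inject₁ i₀)  ≡⟨ sym (agrees-before k f i₀ agree) ⟩
  f zero          ≡⟨ closed ⟩
  f (fromℕ k)     ≡⟨ sym (agrees-after k f i₀ agree) ⟩
  f (suc i₀)      ∎
  where open ≡-Reasoning

-- e is monochromatic under κ.  This is MonoEdge stated through proj₁ and
-- proj₂ instead of a match on ends e, so it reduces for arbitrary edges.

Mono : ∀ {n m t} → Graph n m → (Fin n → Fin t) → Fin m → Set
Mono ends κ e = κ (proj₁ (ends e)) ≡ κ (proj₂ (ends e))

joins-mono⇒ : ∀ {n m t} {ends : Graph n m} {κ : Fin n → Fin t} {e u v} →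
  Joins ends e u v → Mono ends κ e → κ u ≡ κ v
joins-mono⇒ (inj₁ refl) mono = mono
joins-mono⇒ (inj₂ refl) mono = sym mono

joins-mono⇐ : ∀ {n m t} {ends : Graph n m} {κ : Fin n → Fin t} {e u v} →
  Joins ends e u v → κ u ≡ κ v → Mono ends κ e
joins-mono⇐ (inj₁ refl) same = same
joins-mono⇐ (inj₂ refl) same = sym same

data LastMonoSpec {n m t} (ends : Graph n m) (κ : Fin n → Fin t) :
                  Maybe (Fin m) → Set where
  noneMono : (∀ e → ¬ Mono ends κ e) → LastMonoSpec ends κ nothing
  lastMonoIs : ∀ {e} → Mono ends κ e → (∀ e′ → Mono ends κ e′ → toℕ e′ ≤ toℕ e) →
               LastMonoSpec ends κ (just e)

lastMono-spec : ∀ {n m t} (ends : Graph n m) (κ : Fin n → Fin t) →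
  LastMonoSpec ends κ (lastMono ends κ)
lastMono-spec {m = zero} ends κ = noneMono (λ ())
lastMono-spec {m = suc m} ends κ
  with lastMono (λ e → ends (suc e)) κ | lastMono-spec (λ e → ends (suc e)) κ
... | just e | lastMonoIs mono-e above =
  lastMonoIs mono-e λ { zero _ → z≤n ; (suc e′) mono′ → s≤s (above e′ mono′) }
... | nothing | noneMono none-later with ends zero in ends₀
...   | (u , v) with κ u ≟ κ v
...     | yes same = lastMonoIs (subst (λ uv → κ (proj₁ uv) ≡ κ (proj₂ uv)) (sym ends₀) same)
                       λ { zero _ → z≤n ; (suc e′) mono′ → ⊥-elim (none-later e′ mono′) }
...     | no differ = noneMono λ { zero mono₀ → differ (subst (λ uv → κ (proj₁ uv) ≡ κ (proj₂ uv)) ends₀ mono₀)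
                                 ; (suc e′) mono′ → none-later e′ mono′ }

toggle-involutive : ∀ {m} (S : Subset m) e → toggle (toggle S e) e ≡ S
toggle-involutive S e =
  trans (updateAt-updateAt-local e S (not-involutive (lookup S e))) (updateAt-id e S)

toggle-changes : ∀ {m} (S : Subset m) e → toggle S e ≢ S
toggle-changes S e eq =
  not-¬ refl (trans (cong (λ X → lookup X e) (sym eq)) (lookup∘updateAt e S))

toggle-keeps : ∀ {m} (S : Subset m) {e e′} → e′ ≢ e → e′ ∈ S → e′ ∈ toggle S e
toggle-keeps S {e} {e′} e′≢e = updateAt-minimal e′ e S e′≢e

toggle-adds-nothing : ∀ {m} (S : Subset m) {e e′} → e′ ≢ e → e′ ∈ toggle S e → e′ ∈ S
toggle-adds-nothing S {e} {e′} e′≢e e′∈ =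
  subst (e′ ∈_) (toggle-involutive S e) (toggle-keeps (toggle S e) e′≢e e′∈)

toggle-size : ∀ {m} (S : Subset m) e →
  ∣ toggle S e ∣ ≡ suc ∣ S ∣ ⊎ ∣ S ∣ ≡ suc ∣ toggle S e ∣
toggle-size (inside  ∷ S) zero    = inj₂ refl
toggle-size (outside ∷ S) zero    = inj₁ refl
toggle-size (inside  ∷ S) (suc e) with toggle-size S e
... | inj₁ grows  = inj₁ (cong suc grows)
... | inj₂ shrinks = inj₂ (cong suc shrinks)
toggle-size (outside ∷ S) (suc e) = toggle-size S e

sgn-toggle : ∀ {m} (S : Subset m) e → sgn (toggle S e) ≡ - sgn S
sgn-toggle S e with toggle-size S e
... | inj₁ grows rewrite grows = -1*i≡-i (-1ℤ ^ ∣ S ∣)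
... | inj₂ shrinks rewrite shrinks =
  sym (trans (cong -_ (-1*i≡-i (-1ℤ ^ ∣ toggle S e ∣))) (neg-involutive _))

mono-on-edge : ∀ {n m t} {ends : Graph n m} {S} {κ : Fin n → Fin t} {u v} →
  MonoOnComponents ends S κ → AdjIn ends S u v → κ u ≡ κ v
mono-on-edge mono adj = mono _ _ (adj ◅ ε)

mono-from-edges : ∀ {n m t} {ends : Graph n m} {S} {κ : Fin n → Fin t} →
  (∀ {u v} → AdjIn ends S u v → κ u ≡ κ v) → MonoOnComponents ends S κ
mono-from-edges {κ = κ} edges u v =
  fold (λ x y → κ x ≡ κ y) (λ adj same → trans (edges adj) same) refl

toggle-preserves-mono : ∀ {n m t} {ends : Graph n m} {S} {κ : Fin n → Fin t} {e} →
  MonoOnComponents ends S κ → Mono ends κ e → MonoOnComponents ends (toggle S e) κ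
toggle-preserves-mono {ends = ends} {S} {κ} {e} mono mono-e = mono-from-edges edge
  where
  edge : ∀ {u v} → AdjIn ends (toggle S e) u v → κ u ≡ κ v
  edge (e′ , e′∈ , joins) with e′ ≟ e
  ... | yes refl  = joins-mono⇒ {ends = ends} joins mono-e
  ... | no e′≢e   = mono-on-edge mono (e′ , toggle-adds-nothing S e′≢e e′∈ , joins)

-- If κ is monochromatic on the components of S and every edge of a cycle
-- other than es i₀ lies in S, then es i₀ is monochromatic as well: the
-- colour is constant along the path formed by the other edges.
cycle-closing-edge : ∀ {n m t} {ends : Graph n m} {S} {κ : Fin n → Fin t} →
  MonoOnComponents ends S κ → (c : CycleData ends) (i₀ : Fin (CycleData.k c)) →
  (∀ j → j ≢ i₀ → CycleData.es c j ∈ S) → Mono ends κ (CycleData.es c i₀)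
cycle-closing-edge {ends = ends} {κ = κ} mono c i₀ others∈S =
  joins-mono⇐ {ends = ends} {κ = κ} (joins i₀)
    (closing-step-agrees k (λ i → κ (vs i)) i₀ others-agree (cong κ closed))
  where
  open CycleData c
  others-agree : AgreesExcept (λ i → κ (vs i)) i₀
  others-agree j j≢i₀ = mono-on-edge mono (es j , others∈S j j≢i₀ , joins j)

broken-circuit-witness : ∀ {n m t} {ends : Graph n m} {S B} {κ : Fin n → Fin t} →
  MonoOnComponents ends S κ → IsBrokenCircuit ends B → (∀ b → b ∈ B → b ∈ S) →
  ∃[ e₀ ] (Mono ends κ e₀ × (∀ b → b ∈ B → toℕ b < toℕ e₀))
broken-circuit-witness {B = B} mono (c , i₀ , es-below , B-edges) B⊆S =
  es i₀ , cycle-closing-edge mono c i₀ (λ j j≢i₀ → B⊆S (es j) (others∈B j j≢i₀)) , B-below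
  where
  open CycleData c
  others∈B : ∀ j → j ≢ i₀ → es j ∈ B
  others∈B j j≢i₀ = proj₂ (B-edges (es j)) j refl (λ eq → j≢i₀ (esInj j i₀ eq))
  B-below : ∀ b → b ∈ B → toℕ b < toℕ (es i₀)
  B-below b b∈B with proj₁ (B-edges b) b∈B
  ... | j , refl , b≢max = ≤∧≢⇒< (es-below j) (λ eq → b≢max (toℕ-injective eq))

lastMono-found : ∀ {n m t} (ends : Graph n m) (κ : Fin n → Fin t) {e₀} → Mono ends κ e₀ →
  ∃[ e ] (lastMono ends κ ≡ just e × Mono ends κ e × (∀ e′ → Mono ends κ e′ → toℕ e′ ≤ toℕ e))
lastMono-found ends κ {e₀} mono-e₀ with lastMono ends κ | lastMono-spec ends κ
... | nothing | noneMono no-mono        = ⊥-elim (no-mono e₀ mono-e₀)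
... | just e  | lastMonoIs mono-e e-last = e , refl , mono-e , e-last

ι-toggles : ∀ {n m t} (ends : Graph n m) {κ : Fin n → Fin t} S {e} →
  lastMono ends κ ≡ just e → ι ends (S , κ) ≡ (toggle S e , κ)
ι-toggles ends S last≡e rewrite last≡e = refl

-- A broken circuit in S yields a monochromatic edge, so
-- the last monochromatic edge e exists and lies above the whole broken
-- circuit; ι toggles e, and the circuit survives the toggle.
proposition3p1 : (n m t : ℕ) → 1 ≤ t → (ends : Graph n m) →
    (x : Subset m × (Fin n → Fin t)) → InT ends x →
      InT ends (ι ends x) × ι ends (ι ends x) ≡ x × ι ends x ≢ x
        × sgn (proj₁ (ι ends x)) ≡ - sgn (proj₁ x)
proposition3p1 n m t _ ends (S , κ) (mono , B , broken , B⊆S)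
  with broken-circuit-witness mono broken B⊆S
... | e₀ , mono-e₀ , B-below-e₀ with lastMono-found ends κ mono-e₀
...   | e , last≡e , mono-e , e-last
  rewrite ι-toggles ends S last≡e | ι-toggles ends (toggle S e) last≡e =
  ( (toggle-preserves-mono mono mono-e , B , broken , B⊆toggled)
  , cong (_, κ) (toggle-involutive S e)
  , (λ eq → toggle-changes S e (cong proj₁ eq))
  , sgn-toggle S e )
  where
  B⊆toggled : ∀ b → b ∈ B → b ∈ toggle S e
  B⊆toggled b b∈B = toggle-keeps S b≢e (B⊆S b b∈B)
    where
    b≢e : b ≢ e
    b≢e refl = <-irrefl refl (<-≤-trans (B-below-e₀ b b∈B) (e-last e₀ mono-e₀))
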